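{- For $\mathbf{o}\in\mathbb{R}^{\Upsilon}$ the following three conditions are equivalent: (0) $\mathbf{o}$ is an SE objective; (a) for every $Z\subseteq N$ and distinct $a,b\in N\setminus Z$, $\mathbf{o}(b|\{a\}\cup Z)+\mathbf{o}(a|Z)=\mathbf{o}(a|\{b\}\cup Z)+\mathbf{o}(b|Z)$; (b) there exists $m\in\mathbb{R}^{\Upsilon_c}$ such that $\mathbf{o}(a|B)=m(\{a\}\cup B)-m(B)$ for every $a\in N$ and $B\subseteq N\setminus\{a\}$. In particular, the linear subspace of SE objectives in $\mathbb{R}^{\Upsilon}$ has dimension $2^n-n-1$.
   Context: Let $N$ be a finite set with $n=|N|\ge 2$, and let $\mathrm{DAG}(N)$ be the set of acyclic directed graphs with node set $N$; $\mathrm{pa}_G(a)$ denotes the set of parents of $a$ in $G$. Two graphs $G,H\in\mathrm{DAG}(N)$ are Markov equivalent, written $G\sim H$, if they have the same adjacencies and the same immoralities (induced subgraphs $a\to c\leftarrow b$ with $a,b$ non-adjacent). Let $\Upsilon=\{(a|B): a\in N,\ \emptyset\neq B\subseteq N\setminus\{a\}\}$ and $\Upsilon_c=\{S\subseteq N: |S|\ge 2\}$. For $G\in\mathrm{DAG}(N)$, $\eta_G\in\mathbb{R}^{\Upsilon}$ is given by $\eta_G(a|B)=1$ if $B=\mathrm{pa}_G(a)$ and $0$ otherwise; $\langle\mathbf{o},\eta\rangle=\sum_{(a|B)\in\Upsilon}\mathbf{o}(a|B)\eta(a|B)$. A vector $\mathbf{o}\in\mathbb{R}^{\Upsilon}$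 is an SE (score equivalent) objective if $\langle\mathbf{o},\eta_G\rangle=\langle\mathbf{o},\eta_H\rangle$ whenever $G,H\in\mathrm{DAG}(N)$ and $G\sim H$. Conventions: $\mathbf{o}(b|\emptyset)=0$ for every $b\in N$, and for $m\in\mathbb{R}^{\Upsilon_c}$, $m(S)=0$ whenever $S\subseteq N$, $|S|\le 1$. -}

module Defs where

open import Level using (Level; _⊔_)
open import Data.Nat using (ℕ; zero; suc; _≤_; _≤?_)
open import Data.Fin using (Fin)
import Data.Fin as F
open import Data.Fin.Subset using (Subset; _∈_; _∉_; ⁅_⁆; _∪_; ∣_∣; ⊥)
open import Data.Vec using (_∷_; [])
open import Data.List using (List; []; _∷_; map; _++_; filter; length)
open import Data.Bool using (true; false)
open import Data.Product using (_×_; Σ)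
open import Data.Sum using (_⊎_)
open import Relation.Nullary using (¬_)
open import Relation.Binary.PropositionalEquality using (_≡_; _≢_)
open import Relation.Binary.Construct.Closure.Transitive using (TransClosure)
open import Algebra.Bundles using (CommutativeRing)

_⇔_ : ∀ {a b} → Set a → Set b → Set (a ⊔ b)
A ⇔ B = (A → B) × (B → A)

allSubsets : (n : ℕ) → List (Subset n)
allSubsets zero = [] ∷ []
allSubsets (suc n) = map (false ∷_) (allSubsets n) ++ map (true ∷_) (allSubsets n)

card-Υc : ℕ → ℕ
card-Υc n = length (filter (λ S → 2 ≤? ∣ S ∣) (allSubsets n))

-- Directed graphs on N = Fin n, given by their parent sets.
-- Edge G a b  means  a → b  in G, i.e. a ∈ pa_G(b).

Graph : ℕ → Set
Graph n = Fin n → Subset n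

module _ {n : ℕ} (G : Graph n) where

  Edge : Fin n → Fin n → Set
  Edge a b = a ∈ G b

  Acyclic : Set
  Acyclic = ∀ a → ¬ TransClosure Edge a a

  Adj : Fin n → Fin n → Set
  Adj a b = Edge a b ⊎ Edge b a

  Immorality : Fin n → Fin n → Fin n → Set
  Immorality a c b = Edge a c × Edge b c × a ≢ b × ¬ Adj a b

_∼_ : ∀ {n} → Graph n → Graph n → Set
G ∼ H = (∀ a b → Adj G a b ⇔ Adj H a b)
      × (∀ a c b → Immorality G a c b ⇔ Immorality H a c b)

-- Objectives over a commutative ring R (ℝ in the paper).

module Objectives {c ℓ : Level} (R : CommutativeRing c ℓ) (n : ℕ) where
  open CommutativeRing R

  -- o ∈ R^Υ, represented as a function on pairs (a , B); only the
  -- values with B ≠ ∅ and a ∉ B (the set Υ) are meaningful.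
  Obj : Set c
  Obj = Fin n → Subset n → Carrier

  -- m ∈ R^{Υ_c}, represented on all subsets; only |S| ≥ 2 is meaningful.
  Mfun : Set c
  Mfun = Subset n → Carrier

  -- convention o(b|∅) = 0
  oval : Obj → Fin n → Subset n → Carrier
  oval o a B with ∣ B ∣
  ... | zero  = 0#
  ... | suc _ = o a B

  -- convention m(S) = 0 for |S| ≤ 1
  mval : Mfun → Subset n → Carrier
  mval m S with ∣ S ∣
  ... | zero        = 0#
  ... | suc zero    = 0#
  ... | suc (suc _) = m S

  sumFin : ∀ {k} → (Fin k → Carrier) → Carrier
  sumFin {zero}  f = 0#
  sumFin {suc k} f = f F.zero + sumFin (λ i → f (F.suc i))

  score : Obj → Graph n → Carrier
  score o G = sumFin (λ a → oval o a (G a))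

  SE : Obj → Set ℓ
  SE o = (G H : Graph n) → Acyclic G → Acyclic H → G ∼ H → score o G ≈ score o H

  CondA : Obj → Set ℓ
  CondA o = (Z : Subset n) (a b : Fin n) → a ∉ Z → b ∉ Z → a ≢ b →
    oval o b (⁅ a ⁆ ∪ Z) + oval o a Z ≈ oval o a (⁅ b ⁆ ∪ Z) + oval o b Z

  Represents : Mfun → Obj → Set ℓ
  Represents m o = (a : Fin n) (B : Subset n) → a ∉ B →
    oval o a B ≈ mval m (⁅ a ⁆ ∪ B) - mval m B

  CondB : Obj → Set (c ⊔ ℓ)
  CondB o = Σ Mfun (λ m → Represents m o)

  _≈c_ : Mfun → Mfun → Set ℓ
  m ≈c m' = (S : Subset n) → 2 ≤ ∣ S ∣ → m S ≈ m' S

  -- Dimension claim (together with (0) ⇒ (b) and |Υ_c| = 2^n − n − 1):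
  -- the linear map R^{Υ_c} → R^Υ, m ↦ o_m of (b) is injective, so it is
  -- a linear isomorphism onto the subspace of SE objectives.
  Uniqueness : Set (c ⊔ ℓ)
  Uniqueness = (o : Obj) → SE o → (m m' : Mfun) →
    Represents m o → Represents m' o → m ≈c m'

{-# OPTIONS --safe #-}
module Submission where

open import Defs
open import Level using (Level)
open import Data.Nat using (ℕ; _≤_; _^_; _∸_)
open import Data.Product using (_×_)
open import Relation.Binary.PropositionalEquality using (_≡_)
open import Algebra.Bundles using (CommutativeRing)

open import Data.Bool using (true; false; if_then_else_)
open import Data.Empty using (⊥-elim)
open import Data.Fin using (Fin; zero; suc; _≟_)
open import Data.Fin.Properties using (suc-injective; any?)
open import Data.Fin.Subset
  using (Subset; inside; outside; _∈_; _∉_; _⊆_; _⊂_; ⁅_⁆; _∪_; _─_; ∣_∣; ⊥)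
open import Data.Fin.Subset.Induction using (Acc; acc; ⊂-wellFounded)
open import Data.Fin.Subset.Properties
  using ( _∈?_; _⊆?_; drop-there; x∈⁅x⁆; x∈⁅y⁆⇒x≡y; x∈p∪q⁻; p⊆p∪q; q⊆p∪q; ∪-identityˡ
        ; ∉⊥; ∣⊥∣≡0; x∈p⇒p-x⊂p; x∈p∧x≢y⇒x∈p-y; p─q⊆p)
open import Data.Nat using (_<_; s≤s; z≤n)
open import Data.Nat.Properties using (<-irrefl; <-trans; n≤0⇒n≡0; m≤n⇒m≤1+n)
open import Data.Product using (_,_; proj₁; proj₂; ∃; ∃-syntax)
import Data.Product as Prod
open import Data.Sum using (_⊎_; inj₁; inj₂)
import Data.Sum as Sum
open import Data.Vec using ([]; _∷_; here; there)
open import Function using (id; _∘_)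
open import Relation.Binary.Construct.Closure.Transitive using (TransClosure; [_]; _∷_; _∷ʳ_)
import Relation.Binary.PropositionalEquality as ≡
open import Relation.Binary.PropositionalEquality using (_≢_)
open import Relation.Nullary using (¬_; Dec; yes; no; does; _×-dec_; _⊎-dec_)
open import Relation.Nullary.Decidable using (map′; does-≡; dec-true; dec-false)

-- (0) ⇒ (a): let every vertex of Z point to a and to b, and add a → b.  Reversing this covered
-- arrow gives a Markov equivalent DAG, and equating the two scores is exactly (a).
-- (a) ⇒ (b): let m(S) be the score of the complete DAG on S ordered by index.  Condition (a) says
-- that swapping two consecutive elements of the order does not change the score, whence
-- o(a|B) = m({a} ∪ B) − m(B); the same recursion recovers any such m from o (uniqueness).
-- (b) ⇒ (0): write m(S) = Σ_{T ⊆ S} d(T) by Möbius inversion.  The term of a in the score is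
-- then the sum of d(T) over a ∈ T ⊆ {a} ∪ pa(a); in a DAG each T has at most one such head a, so
-- the score is Σ_T d(T) c_G(T) for the characteristic imset c_G.  Markov equivalent DAGs have the
-- same c_G, because a head of T in G gives one in H: the sink of T in H.
-- (b) ⇒ (a) goes through (0).

∈⁅a⁆∪⁻ : ∀ {k} {x a : Fin k} {B : Subset k} → x ∈ ⁅ a ⁆ ∪ B → x ≡ a ⊎ x ∈ B
∈⁅a⁆∪⁻ {a = a} {B} = Sum.map₁ (x∈⁅y⁆⇒x≡y a) ∘ x∈p∪q⁻ ⁅ a ⁆ B

⁅0⁆∪outside : ∀ {k} (S : Subset k) → ⁅ zero ⁆ ∪ (outside ∷ S) ≡ inside ∷ S
⁅0⁆∪outside S = ≡.cong (inside ∷_) (∪-identityˡ S)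

module _ {n : ℕ} where

  Edge? : (G : Graph n) (u v : Fin n) → Dec (Edge G u v)
  Edge? G u v = u ∈? G v

  Adj? : (G : Graph n) (u v : Fin n) → Dec (Adj G u v)
  Adj? G u v = Edge? G u v ⊎-dec Edge? G v u

  ∼-sym : {G H : Graph n} → G ∼ H → H ∼ G
  ∼-sym (adj , imm) = (λ u v → Prod.swap (adj u v)) , (λ u w v → Prod.swap (imm u w v))

  ranked⇒acyclic : (G : Graph n) (rank : Fin n → ℕ) →
                   (∀ u v → Edge G u v → rank u < rank v) → Acyclic G
  ranked⇒acyclic G rank increasing a cycle = <-irrefl ≡.refl (along cycle)
    where
    along : ∀ {u v} → TransClosure (Edge G) u v → rank u < rank v
    along {u} {v} [ e ]             = increasing u v e
    along {u}     (_∷_ {y = y} e p) = <-trans (increasing u y e) (along p)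

  IsSink : Graph n → Subset n → Fin n → Set
  IsSink G T t = t ∈ T × (∀ {s} → s ∈ T → ¬ Edge G t s)

  sink-reachable : (G : Graph n) → Acyclic G → (T : Subset n) → Acc _⊂_ T → ∀ {x} → x ∈ T →
                   ∃[ t ] IsSink G T t × (x ≡ t ⊎ TransClosure (Edge G) x t)
  sink-reachable G acyclic T (acc smaller) {x} x∈T with any? (λ y → y ∈? T ×-dec Edge? G x y)
  ... | no no-successor = x , (x∈T , λ s∈T x→s → no-successor (_ , s∈T , x→s)) , inj₁ ≡.refl
  ... | yes (y , y∈T , x→y) =
    extend (sink-reachable G acyclic (T ─ ⁅ x ⁆) (smaller (x∈p⇒p-x⊂p x∈T))
                           (x∈p∧x≢y⇒x∈p-y y∈T λ { ≡.refl → acyclic x [ x→y ] }))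
    where
    extend : ∃[ t ] IsSink G (T ─ ⁅ x ⁆) t × (y ≡ t ⊎ TransClosure (Edge G) y t) →
             ∃[ t ] IsSink G T t × (x ≡ t ⊎ TransClosure (Edge G) x t)
    extend (t , (t∈T-x , t-sink) , y⇝t) = t , (p─q⊆p T ⁅ x ⁆ t∈T-x , sink) , inj₂ x⇝t
      where
      x⇝t : TransClosure (Edge G) x t
      x⇝t = Sum.[ (λ { ≡.refl → [ x→y ] }) , x→y ∷_ ] y⇝t
      sink : ∀ {s} → s ∈ T → ¬ Edge G t s
      sink {s} s∈T t→s with s ≟ x
      ... | yes ≡.refl = acyclic x (x⇝t ∷ʳ t→s)
      ... | no  s≢x    = t-sink (x∈p∧x≢y⇒x∈p-y s∈T s≢x) t→s

  sink-exists : (G : Graph n) → Acyclic G → ∀ {T x} → x ∈ T → ∃[ t ] IsSink G T t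
  sink-exists G acyclic {T} x∈T =
    Prod.map₂ proj₁ (sink-reachable G acyclic T (⊂-wellFounded T) x∈T)

  -- The characteristic imset of G is c_G(T) = 1 if T has a head in G, and 0 otherwise.
  Headed : Graph n → Subset n → Fin n → Set
  Headed G T a = a ∈ T × T ⊆ ⁅ a ⁆ ∪ G a

  headed? : (G : Graph n) (T : Subset n) (a : Fin n) → Dec (Headed G T a)
  headed? G T a = a ∈? T ×-dec T ⊆? ⁅ a ⁆ ∪ G a

  headed⇒parent : ∀ {G T a s} → Headed G T a → s ∈ T → s ≢ a → Edge G s a
  headed⇒parent (_ , T⊆fa) s∈T s≢a = Sum.[ ⊥-elim ∘ s≢a , id ] (∈⁅a⁆∪⁻ (T⊆fa s∈T))

  headed-unique : ∀ {G T} → Acyclic G → ∀ {a b} → Headed G T a → Headed G T b → a ≡ b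
  headed-unique {G} acyclic {a} {b} ha hb with a ≟ b
  ... | yes a≡b = a≡b
  ... | no  a≢b = ⊥-elim (acyclic a (headed⇒parent {G} hb (proj₁ ha) a≢b
                                    ∷ [ headed⇒parent {G} ha (proj₁ hb) (a≢b ∘ ≡.sym) ]))

  -- Unless s or t is the head i, both are parents of i; were they non-adjacent, the immorality
  -- s → i ← t would also be in H, and its arrow t → i would leave the sink t.
  headed-members-adjacent : ∀ {G H T i t s} → G ∼ H → Headed G T i → IsSink H T t →
                            s ∈ T → s ≢ t → Adj G s t
  headed-members-adjacent {G} {H} {T} {i} {t} {s} (_ , imm) hi (t∈T , t-sink) s∈T s≢t
    with t ≟ i | s ≟ i
  ... | yes ≡.refl | _          = inj₁ (headed⇒parent {G} hi s∈T s≢t)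
  ... | no _       | yes ≡.refl = inj₂ (headed⇒parent {G} hi t∈T (s≢t ∘ ≡.sym))
  ... | no t≢i     | no s≢i with Adj? G s t
  ...   | yes adj = adj
  ...   | no ¬adj = ⊥-elim (t-sink (proj₁ hi) t→i)
    where
    t→i : Edge H t i
    t→i = proj₁ (proj₂ (proj₁ (imm s i t)
            (headed⇒parent {G} hi s∈T s≢i , headed⇒parent {G} hi t∈T t≢i , s≢t , ¬adj)))

  -- The head in H is the sink of T in H.
  headed-transfer : ∀ {G H T} → Acyclic H → G ∼ H → ∃ (Headed G T) → ∃ (Headed H T)
  headed-transfer {H = H} {T} acyclic G∼H (i , hi) with sink-exists H acyclic (proj₁ hi)
  ... | t , t-sink@(t∈T , t↛) = t , t∈T , member
    where
    member : T ⊆ ⁅ t ⁆ ∪ H t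
    member {s} s∈T with s ≟ t
    ... | yes ≡.refl = p⊆p∪q (H t) (x∈⁅x⁆ t)
    ... | no  s≢t    = q⊆p∪q ⁅ t ⁆ (H t) (Sum.[ id , ⊥-elim ∘ t↛ s∈T ]
        (proj₁ (proj₁ G∼H s t) (headed-members-adjacent G∼H hi t-sink s∈T s≢t)))

  -- The arrow a → b is covered: pa(b) = pa(a) ∪ {a}.
  coveredPair : Subset n → Fin n → Fin n → Graph n
  coveredPair Z a b v = if does (v ≟ b) then ⁅ a ⁆ ∪ Z else if does (v ≟ a) then Z else ⊥

  module CoveredPair (Z : Subset n) {a b : Fin n} (a≢b : a ≢ b) where

    G : Graph n
    G = coveredPair Z a b

    pa-b : G b ≡ ⁅ a ⁆ ∪ Z
    pa-b rewrite dec-true (b ≟ b) ≡.refl = ≡.refl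

    pa-a : G a ≡ Z
    pa-a rewrite dec-false (a ≟ b) a≢b | dec-true (a ≟ a) ≡.refl = ≡.refl

    pa-other : ∀ {v} → v ≢ a → v ≢ b → G v ≡ ⊥
    pa-other {v} v≢a v≢b rewrite dec-false (v ≟ b) v≢b | dec-false (v ≟ a) v≢a = ≡.refl

    edge-cases : ∀ {u v} → Edge G u v → (u ≡ a × v ≡ b) ⊎ (u ∈ Z × (v ≡ a ⊎ v ≡ b))
    edge-cases {u} {v} u→v with v ≟ b | v ≟ a
    ... | yes ≡.refl | _          = Sum.map (_, ≡.refl) (_, inj₂ ≡.refl) (∈⁅a⁆∪⁻ u→v)
    ... | no _       | yes ≡.refl = inj₂ (u→v , inj₁ ≡.refl)
    ... | no _       | no _       = ⊥-elim (∉⊥ u→v)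

    a→b : Edge G a b
    a→b = ≡.subst (a ∈_) (≡.sym pa-b) (p⊆p∪q Z (x∈⁅x⁆ a))

    Z⇉ : ∀ {u v} → u ∈ Z → v ≡ a ⊎ v ≡ b → Edge G u v
    Z⇉ {u} u∈Z (inj₁ ≡.refl) = ≡.subst (u ∈_) (≡.sym pa-a) u∈Z
    Z⇉ {u} u∈Z (inj₂ ≡.refl) = ≡.subst (u ∈_) (≡.sym pa-b) (q⊆p∪q ⁅ a ⁆ Z u∈Z)

    -- a is never a parent in an immorality: the other parent of b lies in Z = pa(a).
    immoral-parent∈Z : ∀ {u w v} → Immorality G u w v → u ∈ Z
    immoral-parent∈Z {u} {w} {v} (u→w , v→w , u≢v , ¬adj) with edge-cases {u} {w} u→w
    ... | inj₂ (u∈Z , _) = u∈Z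
    ... | inj₁ (≡.refl , ≡.refl) with edge-cases {v} {w} v→w
    ...   | inj₁ (v≡a , _) = ⊥-elim (u≢v (≡.sym v≡a))
    ...   | inj₂ (v∈Z , _) = ⊥-elim (¬adj (inj₂ (Z⇉ v∈Z (inj₁ ≡.refl))))

  coveredPair-acyclic : ∀ {Z a b} → a ∉ Z → b ∉ Z → a ≢ b → Acyclic (coveredPair Z a b)
  coveredPair-acyclic {Z} {a} {b} a∉Z b∉Z a≢b = ranked⇒acyclic G rank increasing
    where
    open CoveredPair Z a≢b
    rank : Fin n → ℕ
    rank v = if does (v ≟ b) then 2 else if does (v ≟ a) then 1 else 0
    rank-a : rank a ≡ 1
    rank-a rewrite dec-false (a ≟ b) a≢b | dec-true (a ≟ a) ≡.refl = ≡.refl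
    rank-b : rank b ≡ 2
    rank-b rewrite dec-true (b ≟ b) ≡.refl = ≡.refl
    rank-Z : ∀ {u} → u ∈ Z → rank u ≡ 0
    rank-Z {u} u∈Z rewrite dec-false (u ≟ b) (λ { ≡.refl → b∉Z u∈Z })
                         | dec-false (u ≟ a) (λ { ≡.refl → a∉Z u∈Z }) = ≡.refl
    increasing : ∀ u v → Edge G u v → rank u < rank v
    increasing u v u→v with edge-cases {u} {v} u→v
    ... | inj₁ (≡.refl , ≡.refl)   rewrite rank-a     | rank-b = s≤s (s≤s z≤n)
    ... | inj₂ (u∈Z , inj₁ ≡.refl) rewrite rank-Z u∈Z | rank-a = s≤s z≤n
    ... | inj₂ (u∈Z , inj₂ ≡.refl) rewrite rank-Z u∈Z | rank-b = s≤s z≤n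

  coveredPair-adj-reverse : ∀ {Z a b u v} → a ≢ b →
                            Adj (coveredPair Z a b) u v → Adj (coveredPair Z b a) u v
  coveredPair-adj-reverse {Z} a≢b = Sum.[ edge , Sum.swap ∘ edge ]
    where
    module G = CoveredPair Z a≢b
    module H = CoveredPair Z (a≢b ∘ ≡.sym)
    edge : ∀ {u v} → Edge G.G u v → Adj H.G u v
    edge {u} {v} u→v with G.edge-cases {u} {v} u→v
    ... | inj₁ (≡.refl , ≡.refl) = inj₂ H.a→b
    ... | inj₂ (u∈Z , v∈ab)      = inj₁ (H.Z⇉ u∈Z (Sum.swap v∈ab))

  coveredPair-immorality-reverse : ∀ {Z a b u w v} → a ≢ b →
    Immorality (coveredPair Z a b) u w v → Immorality (coveredPair Z b a) u w v
  coveredPair-immorality-reverse {Z} {a} {b} {u} {w} {v} a≢b imm@(u→w , v→w , u≢v , ¬adj) =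
    H.Z⇉ u∈Z w∈ba , H.Z⇉ v∈Z w∈ba , u≢v , ¬adj ∘ coveredPair-adj-reverse (a≢b ∘ ≡.sym)
    where
    module G = CoveredPair Z a≢b
    module H = CoveredPair Z (a≢b ∘ ≡.sym)
    u∈Z = G.immoral-parent∈Z {u} {w} {v} imm
    v∈Z = G.immoral-parent∈Z {v} {w} {u} (v→w , u→w , u≢v ∘ ≡.sym , ¬adj ∘ Sum.swap)
    w∈ba : w ≡ b ⊎ w ≡ a
    w∈ba = Sum.swap (Sum.[ inj₂ ∘ proj₂ , proj₂ ] (G.edge-cases {u} {w} u→w))

  coveredPair-reverse : ∀ {Z a b} → a ≢ b → coveredPair Z a b ∼ coveredPair Z b a
  coveredPair-reverse a≢b =
      (λ u v → coveredPair-adj-reverse a≢b , coveredPair-adj-reverse (a≢b ∘ ≡.sym))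
    , (λ u w v → coveredPair-immorality-reverse {w = w} a≢b
               , coveredPair-immorality-reverse {w = w} (a≢b ∘ ≡.sym))

module SetFunctions {c ℓ : Level} (R : CommutativeRing c ℓ) where
  open CommutativeRing R hiding (zero)
  open import Relation.Binary.Reasoning.Setoid setoid
  open import Algebra.Properties.CommutativeSemigroup +-commutativeSemigroup using (interchange)
  open import Algebra.Properties.AbelianGroup +-abelianGroup using (xyx⁻¹≈y; ⁻¹-∙-comm)

  private variable
    k : ℕ

  x+y-y≈x : ∀ x y → x + y - y ≈ x
  x+y-y≈x x y = trans (+-congʳ (+-comm x y)) (xyx⁻¹≈y y x)

  x+[y-x]≈y : ∀ x y → x + (y - x) ≈ y
  x+[y-x]≈y x y = trans (sym (+-assoc x y (- x))) (xyx⁻¹≈y x y)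

  -‿interchange : ∀ x y z w → (x - y) + (z - w) ≈ (x + z) - (y + w)
  -‿interchange x y z w = trans (interchange x (- y) z (- w)) (+-congˡ (⁻¹-∙-comm y w))

  infix 8 [_]·_
  [_]·_ : ∀ {p} {P : Set p} → Dec P → Carrier → Carrier
  [ P? ]· x = if does P? then x else 0#

  module _ {p} {P : Set p} where

    []·-no : (P? : Dec P) {x : Carrier} → ¬ P → [ P? ]· x ≈ 0#
    []·-no (yes p) ¬p = ⊥-elim (¬p p)
    []·-no (no _)  ¬p = refl

    []·-distrib-minus : (P? : Dec P) (x y : Carrier) → [ P? ]· (x - y) ≈ [ P? ]· x - [ P? ]· y
    []·-distrib-minus (yes _) x y = refl
    []·-distrib-minus (no _)  x y = sym (-‿inverseʳ 0#)

    []·-⇔ : ∀ {q} {Q : Set q} (P? : Dec P) (Q? : Dec Q) {x : Carrier} →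
            (P → Q) → (Q → P) → [ P? ]· x ≡ [ Q? ]· x
    []·-⇔ P? Q? {x} P→Q Q→P =
      ≡.cong (λ b → if b then x else 0#) (does-≡ (map′ P→Q Q→P P?) Q?)

  []·-split : ∀ {p q r} {P : Set p} {Q : Set q} {R : Set r}
              (P? : Dec P) (Q? : Dec Q) (R? : Dec R) (x : Carrier) →
              (R → P ⊎ Q) → (P → R) → (Q → R) → (P → ¬ Q) →
              [ R? ]· x ≈ [ P? ]· x + [ Q? ]· x
  []·-split (yes p) (yes q) _       x _    _   _   P→¬Q = ⊥-elim (P→¬Q p q)
  []·-split (yes _) (no _)  (yes _) x _    _   _   _    = sym (+-identityʳ x)
  []·-split (yes p) (no _)  (no ¬r) x _    P→R _   _    = ⊥-elim (¬r (P→R p))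
  []·-split (no _)  (yes _) (yes _) x _    _   _   _    = sym (+-identityˡ x)
  []·-split (no _)  (yes q) (no ¬r) x _    _   Q→R _    = ⊥-elim (¬r (Q→R q))
  []·-split (no ¬p) (no ¬q) (yes r) x R→PQ _   _   _    = ⊥-elim (Sum.[ ¬p , ¬q ] (R→PQ r))
  []·-split (no _)  (no _)  (no _)  x _    _   _   _    = sym (+-identityˡ 0#)

  ∑ˢ : (Subset k → Carrier) → Carrier
  ∑ˢ {ℕ.zero}  f = f []
  ∑ˢ {ℕ.suc k} f = ∑ˢ (f ∘ (outside ∷_)) + ∑ˢ (f ∘ (inside ∷_))

  ∑ˢ-cong : {f g : Subset k → Carrier} → (∀ S → f S ≈ g S) → ∑ˢ f ≈ ∑ˢ g
  ∑ˢ-cong {ℕ.zero}  f≈g = f≈g []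
  ∑ˢ-cong {ℕ.suc k} f≈g = +-cong (∑ˢ-cong (f≈g ∘ (outside ∷_))) (∑ˢ-cong (f≈g ∘ (inside ∷_)))

  ∑ˢ-zero : {f : Subset k → Carrier} → (∀ S → f S ≈ 0#) → ∑ˢ f ≈ 0#
  ∑ˢ-zero {ℕ.zero}  f≈0 = f≈0 []
  ∑ˢ-zero {ℕ.suc k} f≈0 =
    trans (+-cong (∑ˢ-zero (f≈0 ∘ (outside ∷_))) (∑ˢ-zero (f≈0 ∘ (inside ∷_)))) (+-identityˡ 0#)

  ∑ˢ-distrib-+ : (f g : Subset k → Carrier) → ∑ˢ (λ S → f S + g S) ≈ ∑ˢ f + ∑ˢ g
  ∑ˢ-distrib-+ {ℕ.zero}  f g = refl
  ∑ˢ-distrib-+ {ℕ.suc k} f g =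
    trans (+-cong (∑ˢ-distrib-+ (f ∘ (outside ∷_)) (g ∘ (outside ∷_)))
                  (∑ˢ-distrib-+ (f ∘ (inside ∷_)) (g ∘ (inside ∷_))))
          (interchange _ _ _ _)

  ∑ˢ-distrib-minus : (f g : Subset k → Carrier) → ∑ˢ (λ S → f S - g S) ≈ ∑ˢ f - ∑ˢ g
  ∑ˢ-distrib-minus {ℕ.zero}  f g = refl
  ∑ˢ-distrib-minus {ℕ.suc k} f g =
    trans (+-cong (∑ˢ-distrib-minus (f ∘ (outside ∷_)) (g ∘ (outside ∷_)))
                  (∑ˢ-distrib-minus (f ∘ (inside ∷_)) (g ∘ (inside ∷_))))
          (-‿interchange _ _ _ _)

  ζ : (Subset k → Carrier) → Subset k → Carrier
  ζ d S = ∑ˢ λ T → [ T ⊆? S ]· d T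

  μ : (Subset k → Carrier) → Subset k → Carrier
  μ {ℕ.zero}  f S             = f S
  μ {ℕ.suc k} f (outside ∷ S) = μ (f ∘ (outside ∷_)) S
  μ {ℕ.suc k} f (inside ∷ S)  = μ (f ∘ (inside ∷_)) S - μ (f ∘ (outside ∷_)) S

  ζ-distrib-minus : (g h : Subset k → Carrier) (S : Subset k) →
                ζ (λ T → g T - h T) S ≈ ζ g S - ζ h S
  ζ-distrib-minus g h S =
    trans (∑ˢ-cong (λ T → []·-distrib-minus (T ⊆? S) (g T) (h T)))
          (∑ˢ-distrib-minus (λ T → [ T ⊆? S ]· g T) (λ T → [ T ⊆? S ]· h T))

  ζ∘μ≈id : (f : Subset k → Carrier) (S : Subset k) → ζ (μ f) S ≈ f S
  ζ∘μ≈id {ℕ.zero}  f [] = refl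
  ζ∘μ≈id {ℕ.suc k} f (outside ∷ S) = begin
    ζ (μ f₀) S + ∑ˢ {k} (λ _ → 0#) ≈⟨ +-congˡ (∑ˢ-zero {k} (λ _ → refl)) ⟩
    ζ (μ f₀) S + 0#                ≈⟨ +-identityʳ _ ⟩
    ζ (μ f₀) S                     ≈⟨ ζ∘μ≈id f₀ S ⟩
    f₀ S                           ∎
    where f₀ = f ∘ (outside ∷_)
  ζ∘μ≈id {ℕ.suc k} f (inside ∷ S) = begin
    ζ (μ f₀) S + ζ (λ T → μ f₁ T - μ f₀ T) S ≈⟨ +-congˡ (ζ-distrib-minus (μ f₁) (μ f₀) S) ⟩
    ζ (μ f₀) S + (ζ (μ f₁) S - ζ (μ f₀) S)   ≈⟨ +-cong (ζ∘μ≈id f₀ S) ζμf₁-ζμf₀ ⟩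
    f₀ S + (f₁ S - f₀ S)                     ≈⟨ x+[y-x]≈y (f₀ S) (f₁ S) ⟩
    f₁ S                                     ∎
    where
    f₀ f₁ : Subset k → Carrier
    f₀ = f ∘ (outside ∷_)
    f₁ = f ∘ (inside ∷_)
    ζμf₁-ζμf₀ : ζ (μ f₁) S - ζ (μ f₀) S ≈ f₁ S - f₀ S
    ζμf₁-ζμf₀ = +-cong (ζ∘μ≈id f₁ S) (-‿cong (ζ∘μ≈id f₀ S))

  Δ : (Subset k → Carrier) → Fin k → Subset k → Carrier
  Δ M a B = M (⁅ a ⁆ ∪ B) - M B

  Δ-cong : {M M′ : Subset k → Carrier} → (∀ S → M S ≈ M′ S) → ∀ a B → Δ M a B ≈ Δ M′ a B
  Δ-cong M≈M′ a B = +-cong (M≈M′ (⁅ a ⁆ ∪ B)) (-‿cong (M≈M′ B))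

  Δ-zero : (M : Subset (ℕ.suc k) → Carrier) (S : Subset k) →
           Δ M zero (outside ∷ S) ≡ M (inside ∷ S) - M (outside ∷ S)
  Δ-zero M S = ≡.cong (λ X → M X - M (outside ∷ S)) (⁅0⁆∪outside S)

  ζ-Δ : (d : Subset k → Carrier) (a : Fin k) (B : Subset k) → a ∉ B →
        Δ (ζ d) a B ≈ ∑ˢ λ T → [ a ∈? T ×-dec T ⊆? ⁅ a ⁆ ∪ B ]· d T
  ζ-Δ {k} d a B a∉B = begin
    ζ d (⁅ a ⁆ ∪ B) - ζ d B                  ≈⟨ +-congʳ (∑ˢ-cong split) ⟩
    ∑ˢ (λ T → [ T ⊆? B ]· d T + τ T) - ζ d B ≈⟨ +-congʳ (∑ˢ-distrib-+ (λ T → [ T ⊆? B ]· d T) τ) ⟩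
    ζ d B + ∑ˢ τ - ζ d B                     ≈⟨ xyx⁻¹≈y (ζ d B) (∑ˢ τ) ⟩
    ∑ˢ τ                                     ∎
    where
    τ : Subset k → Carrier
    τ T = [ a ∈? T ×-dec T ⊆? ⁅ a ⁆ ∪ B ]· d T
    split : ∀ T → [ T ⊆? ⁅ a ⁆ ∪ B ]· d T ≈ [ T ⊆? B ]· d T + τ T
    split T = []·-split (T ⊆? B) (a ∈? T ×-dec T ⊆? ⁅ a ⁆ ∪ B) (T ⊆? ⁅ a ⁆ ∪ B) (d T)
      cases (λ T⊆B → q⊆p∪q ⁅ a ⁆ B ∘ T⊆B) proj₂ (λ T⊆B (a∈T , _) → a∉B (T⊆B a∈T))
      where
      cases : T ⊆ ⁅ a ⁆ ∪ B → T ⊆ B ⊎ (a ∈ T × T ⊆ ⁅ a ⁆ ∪ B)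
      cases T⊆aB with a ∈? T
      ... | yes a∈T = inj₂ (a∈T , T⊆aB)
      ... | no  a∉T = inj₁ λ x∈T →
        Sum.[ (λ { ≡.refl → ⊥-elim (a∉T x∈T) }) , id ] (∈⁅a⁆∪⁻ (T⊆aB x∈T))

  Exchange : (Fin k → Subset k → Carrier) → Set ℓ
  Exchange f = ∀ Z a b → a ∉ Z → b ∉ Z → a ≢ b →
               f b (⁅ a ⁆ ∪ Z) + f a Z ≈ f a (⁅ b ⁆ ∪ Z) + f b Z

  infix 4 _≈Δ_
  _≈Δ_ : (Fin k → Subset k → Carrier) → (Subset k → Carrier) → Set ℓ
  f ≈Δ M = ∀ a B → a ∉ B → f a B ≈ Δ M a B

  restrict : (Fin (ℕ.suc k) → Subset (ℕ.suc k) → Carrier) → Fin k → Subset k → Carrier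
  restrict f i T = f (suc i) (outside ∷ T)

  exchange-restrict : {f : Fin (ℕ.suc k) → Subset (ℕ.suc k) → Carrier} →
                      Exchange f → Exchange (restrict f)
  exchange-restrict ex Z a b a∉Z b∉Z a≢b =
    ex (outside ∷ Z) (suc a) (suc b) (a∉Z ∘ drop-there) (b∉Z ∘ drop-there) (a≢b ∘ suc-injective)

  ≈Δ-restrict : {f : Fin (ℕ.suc k) → Subset (ℕ.suc k) → Carrier}
                {M : Subset (ℕ.suc k) → Carrier} →
                f ≈Δ M → restrict f ≈Δ M ∘ (outside ∷_)
  ≈Δ-restrict f≈ΔM a B a∉B = f≈ΔM (suc a) (outside ∷ B) (a∉B ∘ drop-there)

  -- potential f S = Σ_{i ∈ S} f i {j ∈ S ∣ j > i}: the score of the complete DAG on S whose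
  -- arrows point from larger to smaller elements.
  potential : (Fin k → Subset k → Carrier) → Subset k → Carrier
  potential {ℕ.zero}  f S             = 0#
  potential {ℕ.suc k} f (outside ∷ S) = potential (restrict f) S
  potential {ℕ.suc k} f (inside ∷ S)  = potential (restrict f) S + f zero (outside ∷ S)

  potential-≈Δ : (f : Fin k → Subset k → Carrier) → Exchange f → f ≈Δ potential f
  potential-≈Δ f ex zero    (inside ∷ B)  zero∉B = ⊥-elim (zero∉B here)
  potential-≈Δ f ex zero    (outside ∷ B) _ =
    ≡.subst (f zero (outside ∷ B) ≈_) (≡.sym (Δ-zero (potential f) B))
      (sym (xyx⁻¹≈y (potential (restrict f) B) (f zero (outside ∷ B))))
  potential-≈Δ f ex (suc a) (outside ∷ B) a∉B =
    potential-≈Δ (restrict f) (exchange-restrict ex) a B (a∉B ∘ there)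
  potential-≈Δ f ex (suc a) (inside ∷ B)  a∉B = begin
    w                   ≈⟨ sym (x+y-y≈x w q) ⟩
    w + q - q           ≈⟨ +-congʳ (sym exchange) ⟩
    p + u - q           ≈⟨ +-congʳ (+-comm p u) ⟩
    u + p - q           ≈⟨ +-assoc u p (- q) ⟩
    u + (p - q)         ≈⟨ +-congʳ ih ⟩
    (P′ - Q′) + (p - q) ≈⟨ -‿interchange P′ Q′ p q ⟩
    (P′ + p) - (Q′ + q) ∎
    where
    w = f (suc a) (inside ∷ B)
    u = f (suc a) (outside ∷ B)
    p = f zero (outside ∷ (⁅ a ⁆ ∪ B))
    q = f zero (outside ∷ B)
    P′ = potential (restrict f) (⁅ a ⁆ ∪ B)
    Q′ = potential (restrict f) B
    ih : u ≈ P′ - Q′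
    ih = potential-≈Δ (restrict f) (exchange-restrict ex) a B (a∉B ∘ there)
    exchange : p + u ≈ w + q
    exchange = ≡.subst (λ X → p + u ≈ f (suc a) X + q) (⁅0⁆∪outside B)
                 (ex (outside ∷ B) (suc a) zero (a∉B ∘ there ∘ drop-there) (λ ()) (λ ()))

  ≈Δ⇒≈potential : (f : Fin k → Subset k → Carrier) (M : Subset k → Carrier) →
                  M ⊥ ≈ 0# → f ≈Δ M → ∀ S → M S ≈ potential f S
  ≈Δ⇒≈potential {ℕ.zero}  f M M⊥≈0 f≈ΔM [] = M⊥≈0
  ≈Δ⇒≈potential {ℕ.suc k} f M M⊥≈0 f≈ΔM (outside ∷ S) =
    ≈Δ⇒≈potential (restrict f) (M ∘ (outside ∷_)) M⊥≈0 (≈Δ-restrict f≈ΔM) S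
  ≈Δ⇒≈potential {ℕ.suc k} f M M⊥≈0 f≈ΔM (inside ∷ S) = begin
    M (inside ∷ S)                                       ≈⟨ sym (x+[y-x]≈y (M (outside ∷ S)) _) ⟩
    M (outside ∷ S) + (M (inside ∷ S) - M (outside ∷ S)) ≈⟨ +-cong ih (sym increment) ⟩
    potential (restrict f) S + f zero (outside ∷ S)      ∎
    where
    ih = ≈Δ⇒≈potential (restrict f) (M ∘ (outside ∷_)) M⊥≈0 (≈Δ-restrict f≈ΔM) S
    increment : f zero (outside ∷ S) ≈ M (inside ∷ S) - M (outside ∷ S)
    increment = ≡.subst (f zero (outside ∷ S) ≈_) (Δ-zero M S) (f≈ΔM zero (outside ∷ S) λ ())

  potential-small : (f : Fin k → Subset k → Carrier) → (∀ i B → ∣ B ∣ ≡ 0 → f i B ≈ 0#) →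
                    ∀ S → ∣ S ∣ ≤ 1 → potential f S ≈ 0#
  potential-small {ℕ.zero}  f f∅≈0 S _ = refl
  potential-small {ℕ.suc k} f f∅≈0 (outside ∷ S) ∣S∣≤1 =
    potential-small (restrict f) (λ i → f∅≈0 (suc i) ∘ (outside ∷_)) S ∣S∣≤1
  potential-small {ℕ.suc k} f f∅≈0 (inside ∷ S) (s≤s ∣S∣≤0) = begin
    potential (restrict f) S + f zero (outside ∷ S) ≈⟨ +-cong small empty ⟩
    0# + 0#                                         ≈⟨ +-identityˡ 0# ⟩
    0#                                              ∎
    where
    small = potential-small (restrict f) (λ i → f∅≈0 (suc i) ∘ (outside ∷_)) S
              (m≤n⇒m≤1+n ∣S∣≤0)
    empty = f∅≈0 zero (outside ∷ S) (n≤0⇒n≡0 ∣S∣≤0)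

module _ {c ℓ : Level} (R : CommutativeRing c ℓ) (n : ℕ) where
  open CommutativeRing R hiding (zero)
  open SetFunctions R
  open Objectives R n
  open import Relation.Binary.Reasoning.Setoid setoid

  private variable
    k : ℕ

  sumFin-cong : {f g : Fin k → Carrier} → (∀ i → f i ≈ g i) → sumFin f ≈ sumFin g
  sumFin-cong {ℕ.zero}  f≈g = refl
  sumFin-cong {ℕ.suc k} f≈g = +-cong (f≈g zero) (sumFin-cong (f≈g ∘ suc))

  sumFin-zero : {f : Fin k → Carrier} → (∀ i → f i ≈ 0#) → sumFin f ≈ 0#
  sumFin-zero {ℕ.zero}  f≈0 = refl
  sumFin-zero {ℕ.suc k} f≈0 = trans (+-cong (f≈0 zero) (sumFin-zero (f≈0 ∘ suc))) (+-identityˡ 0#)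

  sumFin-single : (f : Fin k → Carrier) (a : Fin k) → (∀ i → i ≢ a → f i ≈ 0#) → sumFin f ≈ f a
  sumFin-single f zero    f≈0 =
    trans (+-congˡ (sumFin-zero (λ i → f≈0 (suc i) λ ()))) (+-identityʳ (f zero))
  sumFin-single f (suc a) f≈0 =
    trans (+-cong (f≈0 zero λ ())
                  (sumFin-single (f ∘ suc) a (λ i i≢a → f≈0 (suc i) (i≢a ∘ suc-injective))))
          (+-identityˡ (f (suc a)))

  sumFin-pair : (f : Fin k → Carrier) {a b : Fin k} → a ≢ b →
                (∀ i → i ≢ a → i ≢ b → f i ≈ 0#) → sumFin f ≈ f a + f b
  sumFin-pair f {zero}  {zero}  a≢b f≈0 = ⊥-elim (a≢b ≡.refl)
  sumFin-pair f {zero}  {suc b} a≢b f≈0 =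
    +-congˡ (sumFin-single (f ∘ suc) b (λ i i≢b → f≈0 (suc i) (λ ()) (i≢b ∘ suc-injective)))
  sumFin-pair f {suc a} {zero}  a≢b f≈0 =
    trans (+-congˡ (sumFin-single (f ∘ suc) a (λ i i≢a → f≈0 (suc i) (i≢a ∘ suc-injective) (λ ()))))
          (+-comm (f zero) (f (suc a)))
  sumFin-pair f {suc a} {suc b} a≢b f≈0 =
    trans (+-cong (f≈0 zero (λ ()) (λ ()))
                  (sumFin-pair (f ∘ suc) (a≢b ∘ ≡.cong suc)
                     (λ i i≢a i≢b → f≈0 (suc i) (i≢a ∘ suc-injective) (i≢b ∘ suc-injective))))
          (+-identityˡ (f (suc a) + f (suc b)))

  sumFin-∑ˢ-comm : ∀ {m} (F : Fin k → Subset m → Carrier) →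
                   sumFin (λ a → ∑ˢ (F a)) ≈ ∑ˢ (λ T → sumFin (λ a → F a T))
  sumFin-∑ˢ-comm {ℕ.zero} {m} F = sym (∑ˢ-zero {m} (λ _ → refl))
  sumFin-∑ˢ-comm {ℕ.suc k} F =
    trans (+-congˡ (sumFin-∑ˢ-comm (F ∘ suc))) (sym (∑ˢ-distrib-+ (F zero) _))

  sumFin-[]·-unique : ∀ {p} {P : Fin k → Set p} (P? : ∀ i → Dec (P i)) (x : Carrier) →
                      (∀ {i j} → P i → P j → i ≡ j) →
                      sumFin (λ i → [ P? i ]· x) ≈ [ any? P? ]· x
  sumFin-[]·-unique {ℕ.zero}  P? x unique = refl
  sumFin-[]·-unique {ℕ.suc k} {P = P} P? x unique = split (P? zero)
    where
    rest = sumFin (λ i → [ P? (suc i) ]· x)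
    split : (P₀? : Dec (P zero)) → [ P₀? ]· x + rest ≈ [ P₀? ⊎-dec any? (P? ∘ suc) ]· x
    split (yes P₀) =
      trans (+-congˡ (sumFin-zero λ i → []·-no (P? (suc i)) (λ Pᵢ → 0≢suc (unique P₀ Pᵢ))))
            (+-identityʳ x)
      where
      0≢suc : ∀ {i} → zero ≢ suc i
      0≢suc ()
    split (no _) =
      trans (+-identityˡ rest)
            (sumFin-[]·-unique (P? ∘ suc) x (λ Pᵢ Pⱼ → suc-injective (unique Pᵢ Pⱼ)))

  oval-∅ : (o : Obj) (a : Fin n) (B : Subset n) → ∣ B ∣ ≡ 0 → oval o a B ≈ 0#
  oval-∅ o a B ∣B∣≡0 with ∣ B ∣
  oval-∅ o a B ≡.refl | ℕ.zero = refl

  mval-⊥ : (m : Mfun) → mval m ⊥ ≈ 0#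
  mval-⊥ m with ∣ ⊥ {n} ∣ | ∣⊥∣≡0 n
  ... | ℕ.zero | ≡.refl = refl

  mval-≈ : (m : Mfun) (S : Subset n) → (∣ S ∣ ≤ 1 → m S ≈ 0#) → mval m S ≈ m S
  mval-≈ m S small with ∣ S ∣
  ... | ℕ.zero          = sym (small z≤n)
  ... | ℕ.suc ℕ.zero    = sym (small (s≤s z≤n))
  ... | ℕ.suc (ℕ.suc _) = refl

  mval-large : (m : Mfun) (S : Subset n) → 2 ≤ ∣ S ∣ → mval m S ≡ m S
  mval-large m S large with ∣ S ∣
  mval-large m S (s≤s (s≤s _)) | ℕ.suc (ℕ.suc _) = ≡.refl

  score-coveredPair : (o : Obj) (Z : Subset n) {a b : Fin n} → a ≢ b →
                      score o (coveredPair Z a b) ≈ oval o a Z + oval o b (⁅ a ⁆ ∪ Z)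
  score-coveredPair o Z {a} {b} a≢b = begin
    sumFin (λ v → oval o v (G v))     ≈⟨ sumFin-pair (λ v → oval o v (G v)) a≢b isolated ⟩
    oval o a (G a) + oval o b (G b)   ≡⟨ ≡.cong₂ _+_ (≡.cong (oval o a) pa-a) (≡.cong (oval o b) pa-b) ⟩
    oval o a Z + oval o b (⁅ a ⁆ ∪ Z) ∎
    where
    open CoveredPair Z a≢b
    isolated : ∀ v → v ≢ a → v ≢ b → oval o v (G v) ≈ 0#
    isolated v v≢a v≢b rewrite pa-other v≢a v≢b = oval-∅ o v ⊥ (∣⊥∣≡0 n)

  SE⇒CondA : (o : Obj) → SE o → CondA o
  SE⇒CondA o se Z a b a∉Z b∉Z a≢b = begin
    oval o b (⁅ a ⁆ ∪ Z) + oval o a Z ≈⟨ +-comm _ _ ⟩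
    oval o a Z + oval o b (⁅ a ⁆ ∪ Z) ≈⟨ score-coveredPair o Z a≢b ⟨
    score o (coveredPair Z a b)       ≈⟨ se _ _ (coveredPair-acyclic a∉Z b∉Z a≢b)
                                                 (coveredPair-acyclic b∉Z a∉Z b≢a)
                                                 (coveredPair-reverse a≢b) ⟩
    score o (coveredPair Z b a)       ≈⟨ score-coveredPair o Z b≢a ⟩
    oval o b Z + oval o a (⁅ b ⁆ ∪ Z) ≈⟨ +-comm _ _ ⟩
    oval o a (⁅ b ⁆ ∪ Z) + oval o b Z ∎
    where
    b≢a = a≢b ∘ ≡.sym

  CondA⇒CondB : (o : Obj) → CondA o → CondB o
  CondA⇒CondB o exchange = potential f , λ a B a∉B →
    trans (potential-≈Δ f exchange a B a∉B)
          (Δ-cong (λ S → sym (mval-≈ (potential f) S (potential-small f (oval-∅ o) S))) a B)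
    where f = oval o

  score≈characteristic : (o : Obj) (M : Subset n → Carrier) → oval o ≈Δ M →
                         (G : Graph n) → Acyclic G →
                         score o G ≈ ∑ˢ λ T → [ any? (headed? G T) ]· μ M T
  score≈characteristic o M o≈ΔM G acyclic = begin
    sumFin (λ a → oval o a (G a))                  ≈⟨ sumFin-cong (λ a → o≈ΔM a (G a) (loopless a)) ⟩
    sumFin (λ a → Δ M a (G a))                     ≈⟨ sumFin-cong (λ a → Δ-cong (sym ∘ ζ∘μ≈id M) a (G a)) ⟩
    sumFin (λ a → Δ (ζ d) a (G a))                 ≈⟨ sumFin-cong (λ a → ζ-Δ d a (G a) (loopless a)) ⟩
    sumFin (λ a → ∑ˢ λ T → [ headed? G T a ]· d T) ≈⟨ sumFin-∑ˢ-comm (λ a T → [ headed? G T a ]· d T) ⟩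
    ∑ˢ (λ T → sumFin λ a → [ headed? G T a ]· d T) ≈⟨ ∑ˢ-cong (λ T → sumFin-[]·-unique (headed? G T) (d T)
                                                                   (headed-unique {G = G} acyclic)) ⟩
    ∑ˢ (λ T → [ any? (headed? G T) ]· d T)         ∎
    where
    d = μ M
    loopless : ∀ a → a ∉ G a
    loopless a a∈Ga = acyclic a [ a∈Ga ]

  CondB⇒SE : (o : Obj) → CondB o → SE o
  CondB⇒SE o (m , o≈Δm) G H acyclicG acyclicH G∼H = begin
    score o G                                ≈⟨ score≈characteristic o M o≈Δm G acyclicG ⟩
    ∑ˢ (λ T → [ any? (headed? G T) ]· μ M T) ≈⟨ ∑ˢ-cong (reflexive ∘ same-imset) ⟩
    ∑ˢ (λ T → [ any? (headed? H T) ]· μ M T) ≈⟨ score≈characteristic o M o≈Δm H acyclicH ⟨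
    score o H                                ∎
    where
    M = mval m
    same-imset : ∀ T → [ any? (headed? G T) ]· μ M T ≡ [ any? (headed? H T) ]· μ M T
    same-imset T = []·-⇔ (any? (headed? G T)) (any? (headed? H T))
                     (headed-transfer acyclicH G∼H) (headed-transfer acyclicG (∼-sym G∼H))

  uniqueness : Uniqueness
  uniqueness o _ m m′ o≈Δm o≈Δm′ S 2≤∣S∣ = begin
    m S                  ≡⟨ mval-large m S 2≤∣S∣ ⟨
    mval m S             ≈⟨ ≈Δ⇒≈potential (oval o) (mval m) (mval-⊥ m) o≈Δm S ⟩
    potential (oval o) S ≈⟨ ≈Δ⇒≈potential (oval o) (mval m′) (mval-⊥ m′) o≈Δm′ S ⟨
    mval m′ S            ≡⟨ mval-large m′ S 2≤∣S∣ ⟩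
    m′ S                 ∎

module Counting where
  open import Data.List using (List; []; _∷_; _++_; map; filter; length)
  open import Data.List.Properties using (length-++; filter-++; filter-≐)
  open import Data.Nat using (_+_; _≤?_; pred)
  open import Data.Nat.Properties using (m+n∸n≡m; +-identityʳ)
  open import Data.Nat.Tactic.RingSolver using (solve-∀)
  open import Relation.Unary using (Pred; Decidable)
  open ≡.≡-Reasoning

  atLeast : ℕ → ℕ → ℕ
  atLeast j k = length (filter (λ S → j ≤? ∣ S ∣) (allSubsets k))

  length-filter-map : ∀ {a b p} {A : Set a} {B : Set b} {P : Pred B p} (P? : Decidable P)
                      (f : A → B) (xs : List A) →
                      length (filter P? (map f xs)) ≡ length (filter (P? ∘ f) xs)
  length-filter-map P? f []       = ≡.refl
  length-filter-map P? f (x ∷ xs) with does (P? (f x))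
  ... | true  = ≡.cong ℕ.suc (length-filter-map P? f xs)
  ... | false = length-filter-map P? f xs

  atLeast-suc : ∀ j k → atLeast j (ℕ.suc k) ≡ atLeast j k + atLeast (pred j) k
  atLeast-suc j k = begin
    length (filter P? (map (outside ∷_) Ss ++ map (inside ∷_) Ss))
      ≡⟨ ≡.cong length (filter-++ P? (map (outside ∷_) Ss) _) ⟩
    length (filter P? (map (outside ∷_) Ss) ++ filter P? (map (inside ∷_) Ss))
      ≡⟨ length-++ (filter P? (map (outside ∷_) Ss)) ⟩
    length (filter P? (map (outside ∷_) Ss)) + length (filter P? (map (inside ∷_) Ss))
      ≡⟨ ≡.cong₂ _+_ (length-filter-map P? (outside ∷_) Ss) (length-filter-map P? (inside ∷_) Ss) ⟩
    atLeast j k + length (filter (P? ∘ (inside ∷_)) Ss)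
      ≡⟨ ≡.cong (λ xs → atLeast j k + length xs) (filter-≐ _ _ (pred-≤ j , ≤-pred j) Ss) ⟩
    atLeast j k + atLeast (pred j) k
      ∎
    where
    Ss = allSubsets k
    P? = λ (S : Subset (ℕ.suc k)) → j ≤? ∣ S ∣
    pred-≤ : ∀ j {m} → j ≤ ℕ.suc m → pred j ≤ m
    pred-≤ ℕ.zero    _         = z≤n
    pred-≤ (ℕ.suc j) (s≤s j≤m) = j≤m
    ≤-pred : ∀ j {m} → pred j ≤ m → j ≤ ℕ.suc m
    ≤-pred ℕ.zero    _   = z≤n
    ≤-pred (ℕ.suc j) j≤m = s≤s j≤m

  atLeast-0 : ∀ k → atLeast 0 k ≡ 2 ^ k
  atLeast-0 ℕ.zero    = ≡.refl
  atLeast-0 (ℕ.suc k) = ≡.trans (atLeast-suc 0 k)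
    (≡.cong₂ _+_ (atLeast-0 k) (≡.trans (atLeast-0 k) (≡.sym (+-identityʳ (2 ^ k)))))

  atLeast-1 : ∀ k → atLeast 1 k + 1 ≡ 2 ^ k
  atLeast-1 ℕ.zero    = ≡.refl
  atLeast-1 (ℕ.suc k) = begin
    atLeast 1 (ℕ.suc k) + 1               ≡⟨ ≡.cong (_+ 1) (atLeast-suc 1 k) ⟩
    atLeast 1 k + atLeast 0 k + 1         ≡⟨ regroup (atLeast 1 k) (atLeast 0 k) ⟩
    (atLeast 1 k + 1) + (atLeast 0 k + 0) ≡⟨ ≡.cong₂ _+_ (atLeast-1 k) (≡.cong (_+ 0) (atLeast-0 k)) ⟩
    2 ^ ℕ.suc k                           ∎
    where
    regroup : ∀ x y → x + y + 1 ≡ (x + 1) + (y + 0)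
    regroup = solve-∀

  atLeast-2 : ∀ k → atLeast 2 k + 1 + k ≡ 2 ^ k
  atLeast-2 ℕ.zero    = ≡.refl
  atLeast-2 (ℕ.suc k) = begin
    atLeast 2 (ℕ.suc k) + 1 + ℕ.suc k             ≡⟨ ≡.cong (λ x → x + 1 + ℕ.suc k) (atLeast-suc 2 k) ⟩
    atLeast 2 k + atLeast 1 k + 1 + ℕ.suc k       ≡⟨ regroup (atLeast 2 k) (atLeast 1 k) k ⟩
    (atLeast 2 k + 1 + k) + (atLeast 1 k + 1 + 0) ≡⟨ ≡.cong₂ _+_ (atLeast-2 k) (≡.cong (_+ 0) (atLeast-1 k)) ⟩
    2 ^ ℕ.suc k                                   ∎
    where
    regroup : ∀ x y k → x + y + 1 + ℕ.suc k ≡ (x + 1 + k) + (y + 1 + 0)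
    regroup = solve-∀

  card-Υc≡ : ∀ k → card-Υc k ≡ 2 ^ k ∸ k ∸ 1
  card-Υc≡ k = ≡.sym (begin
    2 ^ k ∸ k ∸ 1               ≡⟨ ≡.cong (λ x → x ∸ k ∸ 1) (atLeast-2 k) ⟨
    atLeast 2 k + 1 + k ∸ k ∸ 1 ≡⟨ ≡.cong (_∸ 1) (m+n∸n≡m (atLeast 2 k + 1) k) ⟩
    atLeast 2 k + 1 ∸ 1         ≡⟨ m+n∸n≡m (atLeast 2 k) 1 ⟩
    atLeast 2 k                 ∎)

lemma5 : {c ℓ : Level} (R : CommutativeRing c ℓ) (n : ℕ) → 2 ≤ n →
    ((o : Objectives.Obj R n) →
      (Objectives.SE R n o ⇔ Objectives.CondA R n o)
      × (Objectives.CondA R n o ⇔ Objectives.CondB R n o))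
    × Objectives.Uniqueness R n
    × card-Υc n ≡ 2 ^ n ∸ n ∸ 1
lemma5 R n _ =
    (λ o → (SE⇒CondA R n o , CondB⇒SE R n o ∘ CondA⇒CondB R n o)
         , (CondA⇒CondB R n o , SE⇒CondA R n o ∘ CondB⇒SE R n o))
  , uniqueness R n
  , Counting.card-Υc≡ n
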